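{- Let $S$ be a numerical semigroup. Then the number of numerical semigroups $\Delta$ that are ideal extensions of $S$ is at most $2^{\mathrm{t}(S)}$.
   Context: A numerical semigroup is a subset $S\subseteq\mathbb{N}$ containing $0$, closed under addition, with finite complement in $\mathbb{N}$. An ideal of a numerical semigroup $\Delta$ is a nonempty $I\subseteq\Delta$ with $I+\Delta\subseteq I$. $\Delta$ is an ideal extension of $S$ if $S\setminus\{0\}$ is an ideal of $\Delta$. $\mathrm{PF}(S)$ is the set of integers $x\notin S$ with $x+s\in S$ for all $s\in S\setminus\{0\}$, and the type $\mathrm{t}(S)$ is the cardinality of $\mathrm{PF}(S)$. -}

module Defs where

open import Data.Nat using (ℕ; _+_; _<_; _≤_; _^_)
open import Data.Integer as ℤ using (ℤ; +_; -[1+_])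
open import Data.Bool using (Bool; true)
open import Data.Product using (Σ; ∃; _×_)
open import Data.Empty using (⊥)
open import Data.List using (List; length)
open import Relation.Binary.PropositionalEquality using (_≡_; _≢_)
open import Relation.Nullary using (¬_)

SubsetNat : Set
SubsetNat = ℕ → Bool

_∈ₙ_ : ℕ → SubsetNat → Set
n ∈ₙ A = A n ≡ true

_∈ℤ_ : ℤ → SubsetNat → Set
(+ n) ∈ℤ A = A n ≡ true
-[1+ n ] ∈ℤ A = ⊥

record IsNumericalSemigroup (S : SubsetNat) : Set where
  field
    zero∈    : 0 ∈ₙ S
    +-closed : ∀ a b → a ∈ₙ S → b ∈ₙ S → (a + b) ∈ₙ S
    cofinite : ∃ λ F → ∀ n → F < n → n ∈ₙ S

record IsIdeal (Δ : SubsetNat) (I : ℕ → Set) : Set where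
  field
    nonempty : ∃ λ x → I x
    ⊆Δ       : ∀ x → I x → x ∈ₙ Δ
    +Δ       : ∀ x d → I x → d ∈ₙ Δ → I (x + d)

nonzeroPart : SubsetNat → ℕ → Set
nonzeroPart S x = x ∈ₙ S × x ≢ 0

IsIdealExtension : SubsetNat → SubsetNat → Set
IsIdealExtension S Δ = IsIdeal Δ (nonzeroPart S)

IsPF : SubsetNat → ℤ → Set
IsPF S x = ¬ (x ∈ℤ S) × (∀ s → s ∈ₙ S → s ≢ 0 → (x ℤ.+ + s) ∈ℤ S)

_≐_ : SubsetNat → SubsetNat → Set
A ≐ B = ∀ n → A n ≡ B n

{-# OPTIONS --safe #-}
-- An ideal extension Δ of S contains S, and every element of Δ ∖ S is a
-- pseudo-Frobenius number of S, because s + x ∈ S \ {0} whenever s ∈ S \ {0}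
-- and x ∈ Δ.  Hence Δ = S ∪ (Δ ∩ PF(S)) is determined by which pseudo-Frobenius
-- numbers it contains, and there are at most 2^t(S) such choices.
module Submission where

open import Defs
open import Data.Nat using (_≤_; _^_; z≤n; s≤s; suc; _+_)
open import Data.Nat.Properties using (+-comm; +-suc; +-mono-≤; +-identityʳ; module ≤-Reasoning)
open import Data.Integer using (ℤ; +_; -[1+_])
open import Data.Bool using (Bool; true; false)
open import Data.Bool.Properties using (¬-not) renaming (_≟_ to _≟ᵇ_)
open import Data.Product using (_×_; _,_; proj₁; proj₂)
open import Data.List using (List; []; _∷_; length; map; filter)
open import Data.List.Properties using (∷-injective)
open import Data.List.Membership.Propositional using (_∈_)
open import Data.List.Relation.Unary.Any using (here; there)
open import Data.List.Relation.Unary.All as All using (All; []; _∷_)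
open import Data.List.Relation.Unary.All.Properties using (all-filter)
open import Data.List.Relation.Unary.AllPairs using (AllPairs; []; _∷_)
open import Data.List.Relation.Unary.AllPairs.Properties using (filter⁺)
open import Data.List.Relation.Unary.Unique.Propositional using (Unique)
open import Data.Empty using (⊥-elim)
open import Relation.Nullary using (¬_; yes; no; does)
open import Relation.Unary using (Pred; Decidable)
open import Relation.Unary.Properties using (∁?)
open import Relation.Binary.PropositionalEquality using (_≡_; _≢_; refl; sym; trans; cong; cong₂; subst)

module _ {a p} {A : Set a} {P : Pred A p} (P? : Decidable P) where

  length-filter+filter-∁ : ∀ xs → length (filter P? xs) + length (filter (∁? P?) xs) ≡ length xs
  length-filter+filter-∁ []       = refl
  length-filter+filter-∁ (x ∷ xs) with does (P? x)
  ... | true  = cong suc (length-filter+filter-∁ xs)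
  ... | false = trans (+-suc _ _) (cong suc (length-filter+filter-∁ xs))

module _ {a p r s} {A : Set a} {P : Pred A p} {R : A → A → Set r} {S : A → A → Set s} where

  AllPairs-mapWithAll : (∀ {x y} → P x → P y → R x y → S x y) →
                        ∀ {xs} → All P xs → AllPairs R xs → AllPairs S xs
  AllPairs-mapWithAll f []         []         = []
  AllPairs-mapWithAll f (px ∷ pxs) (rs ∷ rss) =
    All.zipWith (λ (py , r) → f px py r) (pxs , rs) ∷ AllPairs-mapWithAll f pxs rss

map-≡⇒∈-≡ : ∀ {i b} {I : Set i} {B : Set b} {f g : I → B} {x is} →
            x ∈ is → map f is ≡ map g is → f x ≡ g x
map-≡⇒∈-≡ (here refl) eq = proj₁ (∷-injective eq)
map-≡⇒∈-≡ (there x∈is) eq = map-≡⇒∈-≡ x∈is (proj₂ (∷-injective eq))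

module _ {a i} {A : Set a} {I : Set i} (code : A → I → Bool) where

  Separated : List I → A → A → Set
  Separated is x y = map (code x) is ≢ map (code y) is

  separated-tail : ∀ {j is x y} → code x j ≡ code y j →
                   Separated (j ∷ is) x y → Separated is x y
  separated-tail same sep eq = sep (cong₂ _∷_ same eq)

  separated-filter : ∀ {j is p} {P : Pred A p} (P? : Decidable P) →
                     (∀ {x y} → P x → P y → code x j ≡ code y j) →
                     ∀ {xs} → AllPairs (Separated (j ∷ is)) xs →
                     AllPairs (Separated is) (filter P? xs)
  separated-filter P? same {xs} sep =
    AllPairs-mapWithAll (λ px py → separated-tail (same px py)) (all-filter P? xs) (filter⁺ P? sep)

  separated-length≤2^ : ∀ is xs → AllPairs (Separated is) xs → length xs ≤ 2 ^ length is
  separated-length≤2^ []       []          _               = z≤n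
  separated-length≤2^ []       (_ ∷ [])    _               = s≤s z≤n
  separated-length≤2^ []       (_ ∷ _ ∷ _) ((x≉y ∷ _) ∷ _) = ⊥-elim (x≉y refl)
  separated-length≤2^ (j ∷ is) xs          sep = begin
    length xs
      ≡⟨ sym (length-filter+filter-∁ j-set? xs) ⟩
    length (filter j-set? xs) + length (filter (∁? j-set?) xs)
      ≤⟨ +-mono-≤ (separated-length≤2^ is _ (separated-filter j-set? both-set sep))
                  (separated-length≤2^ is _ (separated-filter (∁? j-set?) both-unset sep)) ⟩
    2 ^ length is + 2 ^ length is
      ≡⟨ cong (λ m → 2 ^ length is + m) (sym (+-identityʳ _)) ⟩
    2 ^ length (j ∷ is) ∎
    where
    open ≤-Reasoning
    j-set? : Decidable (λ x → code x j ≡ true)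
    j-set? x = code x j ≟ᵇ true
    both-set : ∀ {x y} → code x j ≡ true → code y j ≡ true → code x j ≡ code y j
    both-set x-set y-set = trans x-set (sym y-set)
    both-unset : ∀ {x y} → code x j ≢ true → code y j ≢ true → code x j ≡ code y j
    both-unset x-unset y-unset = trans (¬-not x-unset) (sym (¬-not y-unset))

χℤ : SubsetNat → ℤ → Bool
χℤ A (+ n)    = A n
χℤ A -[1+ n ] = false

module _ {S Δ : SubsetNat} (ext : IsIdealExtension S Δ) where

  ⊆-idealExtension : 0 ∈ₙ Δ → ∀ {n} → n ∈ₙ S → n ∈ₙ Δ
  ⊆-idealExtension 0∈Δ {0}     _   = 0∈Δ
  ⊆-idealExtension 0∈Δ {suc n} n∈S = IsIdeal.⊆Δ ext (suc n) (n∈S , λ ())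

  idealExtension-∖⇒PF : ∀ {n} → n ∈ₙ Δ → ¬ n ∈ₙ S → IsPF S (+ n)
  idealExtension-∖⇒PF {n} n∈Δ n∉S = n∉S , λ s s∈S s≢0 →
    subst (_∈ₙ S) (+-comm s n) (proj₁ (IsIdeal.+Δ ext s n (s∈S , s≢0) n∈Δ))

≡-if-either-true : ∀ {a b : Bool} → (a ≡ true → a ≡ b) → (b ≡ true → a ≡ b) → a ≡ b
≡-if-either-true {true}           a⇒ _  = a⇒ refl
≡-if-either-true {false} {true}   _  b⇒ = b⇒ refl
≡-if-either-true {false} {false}  _  _  = refl

idealExtensions-agreeing-on-PF : ∀ {S Δ Δ′} →
  0 ∈ₙ Δ → IsIdealExtension S Δ → 0 ∈ₙ Δ′ → IsIdealExtension S Δ′ →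
  (∀ x → IsPF S x → χℤ Δ x ≡ χℤ Δ′ x) → Δ ≐ Δ′
idealExtensions-agreeing-on-PF {S} 0∈Δ ext 0∈Δ′ ext′ agree n with S n ≟ᵇ true
... | yes n∈S = trans (⊆-idealExtension ext 0∈Δ n∈S) (sym (⊆-idealExtension ext′ 0∈Δ′ n∈S))
... | no  n∉S = ≡-if-either-true
  (λ n∈Δ  → agree (+ n) (idealExtension-∖⇒PF ext  n∈Δ  n∉S))
  (λ n∈Δ′ → agree (+ n) (idealExtension-∖⇒PF ext′ n∈Δ′ n∉S))

corollary4 : (S : SubsetNat) → IsNumericalSemigroup S →
    (pf : List ℤ) → Unique pf →
    (∀ x → (x ∈ pf → IsPF S x) × (IsPF S x → x ∈ pf)) →
    (Δs : List SubsetNat) →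
    AllPairs (λ Δ Δ′ → ¬ (Δ ≐ Δ′)) Δs →
    All (λ Δ → IsNumericalSemigroup Δ × IsIdealExtension S Δ) Δs →
    length Δs ≤ 2 ^ length pf
corollary4 S _ pf _ pf-spec Δs distinct extensions =
  separated-length≤2^ χℤ pf Δs (AllPairs-mapWithAll separated extensions distinct)
  where
  separated : ∀ {Δ Δ′} → IsNumericalSemigroup Δ × IsIdealExtension S Δ →
              IsNumericalSemigroup Δ′ × IsIdealExtension S Δ′ →
              ¬ (Δ ≐ Δ′) → Separated χℤ pf Δ Δ′
  separated (sg , ext) (sg′ , ext′) Δ≉Δ′ same-on-pf =
    Δ≉Δ′ (idealExtensions-agreeing-on-PF
      (IsNumericalSemigroup.zero∈ sg) ext (IsNumericalSemigroup.zero∈ sg′) ext′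
      (λ x x∈PF → map-≡⇒∈-≡ (proj₂ (pf-spec x) x∈PF) same-on-pf))
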